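{- Let $A$ be a dendriform algebra over a field $k$ of characteristic zero, augmented by a unit as in the context, and let $a\in A$. Then for every $n\ge 1$, $$w^{(n)}_{\succ}(a)=\sum_{\substack{i_1+\cdots+i_k=n\\ i_1,\ldots,i_k>0}}\frac{\ell^{(i_1)}(a)*\cdots*\ell^{(i_k)}(a)}{i_1(i_1+i_2)\cdots(i_1+\cdots+i_k)},$$ $$w^{(n)}_{\prec}(a)=\sum_{\substack{i_1+\cdots+i_k=n\\ i_1,\ldots,i_k>0}}\frac{r^{(i_k)}(a)*\cdots*r^{(i_1)}(a)}{i_1(i_1+i_2)\cdots(i_1+\cdots+i_k)}.$$
   Context: A dendriform algebra over $k$ is a $k$-vector space $A$ with bilinear operations $\prec,\succ$ satisfying $(a\prec b)\prec c=a\prec(b*c)$, $(a\succ b)\prec c=a\succ(b\prec c)$, $a\succ(b\succ c)=(a*b)\succ c$, where $a*b:=a\prec b+a\succ b$ (associative). Adjoin a unit $1$ with $a\prec 1:=a$, $1\succ a:=a$, $1\prec a:=0$, $a\succ 1:=0$. Set $w^{(0)}_\prec(a)=w^{(0)}_\succ(a)=1$, $w^{(n)}_\prec(a):=a\prec w^{(n-1)}_\prec(a)$, $w^{(n)}_\succ(a):=w^{(n-1)}_\succ(a)\succ a$. Define the pre-Lie products $a\rhd b:=a\succ b-b\prec a$ and $a\lhd b:=a\prec b-b\succ a$, and $\ell^{(1)}(a)=r^{(1)}(a):=a$, $\ell^{(n+1)}(a):=\ell^{(n)}(a)\rhd a$, $r^{(n+1)}(a):=a\lhd r^{(n)}(a)$.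 -}

module Defs where

open import Level using (Level; _⊔_) renaming (suc to lsuc)
open import Data.Nat using (ℕ; zero; suc) renaming (_+_ to _+ℕ_; _*_ to _*ℕ_)
open import Data.List using (List; []; _∷_; map; _++_; reverse; foldr)
open import Relation.Nullary using (¬_)
open import Relation.Binary.PropositionalEquality using (_≡_; refl)
open import Algebra.Bundles using (CommutativeRing)
open import Algebra.Module.Bundles using (Module)

-- A field is a commutative ring
-- with 0 ≠ 1 in which every nonzero element has a multiplicative
-- inverse; the inverse is given as a total function _⁻¹ whose value
-- at 0# is unconstrained (junk), as is customary.

record Field c ℓ : Set (lsuc (c ⊔ ℓ)) where
  field
    commutativeRing : CommutativeRing c ℓ
  open CommutativeRing commutativeRing public
  field
    _⁻¹        : Carrier → Carrier
    ⁻¹-inverse : ∀ x → ¬ (x ≈ 0#) → (x * (x ⁻¹)) ≈ 1#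
    0≉1        : ¬ (0# ≈ 1#)

module _ {c ℓ} (F : Field c ℓ) where
  open Field F

  ι : ℕ → Carrier
  ι zero    = 0#
  ι (suc n) = 1# + ι n

  CharZero : Set ℓ
  CharZero = ∀ n → ¬ (ι (suc n) ≈ 0#)

record Dendriform {c ℓ} (F : Field c ℓ) m ℓm : Set (c ⊔ ℓ ⊔ lsuc (m ⊔ ℓm)) where
  field
    module′ : Module (Field.commutativeRing F) m ℓm
  open Module module′ public
  field
    _≺_ : Carrierᴹ → Carrierᴹ → Carrierᴹ
    _≻_ : Carrierᴹ → Carrierᴹ → Carrierᴹ

  _∗_ : Carrierᴹ → Carrierᴹ → Carrierᴹ
  x ∗ y = (x ≺ y) +ᴹ (x ≻ y)

  field
    ≺-cong : ∀ {x x′ y y′} → x ≈ᴹ x′ → y ≈ᴹ y′ → (x ≺ y) ≈ᴹ (x′ ≺ y′)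
    ≻-cong : ∀ {x x′ y y′} → x ≈ᴹ x′ → y ≈ᴹ y′ → (x ≻ y) ≈ᴹ (x′ ≻ y′)
    ≺-+ˡ : ∀ x y z → ((x +ᴹ y) ≺ z) ≈ᴹ ((x ≺ z) +ᴹ (y ≺ z))
    ≺-+ʳ : ∀ x y z → (x ≺ (y +ᴹ z)) ≈ᴹ ((x ≺ y) +ᴹ (x ≺ z))
    ≻-+ˡ : ∀ x y z → ((x +ᴹ y) ≻ z) ≈ᴹ ((x ≻ z) +ᴹ (y ≻ z))
    ≻-+ʳ : ∀ x y z → (x ≻ (y +ᴹ z)) ≈ᴹ ((x ≻ y) +ᴹ (x ≻ z))
    ≺-*ₗˡ : ∀ s x y → ((s *ₗ x) ≺ y) ≈ᴹ (s *ₗ (x ≺ y))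
    ≺-*ₗʳ : ∀ s x y → (x ≺ (s *ₗ y)) ≈ᴹ (s *ₗ (x ≺ y))
    ≻-*ₗˡ : ∀ s x y → ((s *ₗ x) ≻ y) ≈ᴹ (s *ₗ (x ≻ y))
    ≻-*ₗʳ : ∀ s x y → (x ≻ (s *ₗ y)) ≈ᴹ (s *ₗ (x ≻ y))
    dend₁ : ∀ a b c → ((a ≺ b) ≺ c) ≈ᴹ (a ≺ (b ∗ c))
    dend₂ : ∀ a b c → ((a ≻ b) ≺ c) ≈ᴹ (a ≻ (b ≺ c))
    dend₃ : ∀ a b c → (a ≻ (b ≻ c)) ≈ᴹ ((a ∗ b) ≻ c)

  _▷_ : Carrierᴹ → Carrierᴹ → Carrierᴹ
  x ▷ y = (x ≻ y) +ᴹ (-ᴹ (y ≺ x))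

  _◁_ : Carrierᴹ → Carrierᴹ → Carrierᴹ
  x ◁ y = (x ≺ y) +ᴹ (-ᴹ (y ≻ x))

  -- For n ≥ 1 these elements lie in A itself.  With the unit conventions
  -- 1 ≻ a = a and a ≺ 1 = a one has w≻⁽¹⁾(a) = w≺⁽¹⁾(a) = a.
  -- The value at index 0 (the adjoined unit 1, resp. undefined for ℓ, r)
  -- is junk (0ᴹ) and never used: the theorem only concerns n ≥ 1.
  w≻ : ℕ → Carrierᴹ → Carrierᴹ
  w≻ zero          a = 0ᴹ
  w≻ (suc zero)    a = a
  w≻ (suc (suc n)) a = w≻ (suc n) a ≻ a

  w≺ : ℕ → Carrierᴹ → Carrierᴹ
  w≺ zero          a = 0ᴹ
  w≺ (suc zero)    a = a
  w≺ (suc (suc n)) a = a ≺ w≺ (suc n) a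

  ℓ⁽_⁾ : ℕ → Carrierᴹ → Carrierᴹ
  ℓ⁽ zero ⁾        a = 0ᴹ
  ℓ⁽ suc zero ⁾    a = a
  ℓ⁽ suc (suc n) ⁾ a = ℓ⁽ suc n ⁾ a ▷ a

  r⁽_⁾ : ℕ → Carrierᴹ → Carrierᴹ
  r⁽ zero ⁾        a = 0ᴹ
  r⁽ suc zero ⁾    a = a
  r⁽ suc (suc n) ⁾ a = a ◁ r⁽ suc n ⁾ a

  -- right-nested ∗-product x₁ ∗ (x₂ ∗ (⋯ ∗ xₖ)) of a list (the product is
  -- associative, so the bracketing is immaterial); the empty product is
  -- junk (0ᴹ) and never occurs (compositions of n ≥ 1 are nonempty).
  ∏∗ : List Carrierᴹ → Carrierᴹ
  ∏∗ []           = 0ᴹ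
  ∏∗ (x ∷ [])     = x
  ∏∗ (x ∷ y ∷ xs) = x ∗ ∏∗ (y ∷ xs)

  Σᴹ : List Carrierᴹ → Carrierᴹ
  Σᴹ = foldr _+ᴹ_ 0ᴹ

-- Compositions of n: all lists (i₁,…,iₖ) of positive naturals with
-- i₁ + ⋯ + iₖ = n.  A composition of n+2 either starts with 1 followed
-- by a composition of n+1, or is a composition of n+1 with first part
-- increased by one.

bumpHead : List ℕ → List ℕ
bumpHead []       = []
bumpHead (i ∷ is) = suc i ∷ is

compositions : ℕ → List (List ℕ)
compositions zero          = [] ∷ []
compositions (suc zero)    = (1 ∷ []) ∷ []
compositions (suc (suc n)) =
  map (1 ∷_) (compositions (suc n)) ++ map bumpHead (compositions (suc n))

_ : compositions 3 ≡ (1 ∷ 1 ∷ 1 ∷ []) ∷ (1 ∷ 2 ∷ []) ∷ (2 ∷ 1 ∷ []) ∷ (3 ∷ []) ∷ []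
_ = refl

denomAux : ℕ → List ℕ → ℕ
denomAux acc []       = 1
denomAux acc (i ∷ is) = (acc +ℕ i) *ℕ denomAux (acc +ℕ i) is

denom : List ℕ → ℕ
denom = denomAux 0

_ : denom (2 ∷ 1 ∷ 3 ∷ []) ≡ 36
_ = refl

module _ {c ℓ m ℓm} {F : Field c ℓ} (D : Dendriform F m ℓm) where
  open Field F using (_⁻¹)
  open Dendriform D

  coeff : List ℕ → Field.Carrier F
  coeff is = (ι F (denom is)) ⁻¹

  rhs≻ : ℕ → Carrierᴹ → Carrierᴹ
  rhs≻ n a = Σᴹ (map (λ is → coeff is *ₗ ∏∗ (map (λ i → ℓ⁽ i ⁾ a) is))
                     (compositions n))

  rhs≺ : ℕ → Carrierᴹ → Carrierᴹ
  rhs≺ n a = Σᴹ (map (λ is → coeff is *ₗ ∏∗ (reverse (map (λ i → r⁽ i ⁾ a) is)))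
                     (compositions n))

-- Both sides of the ≻-formula satisfy the recursion
--   n u⁽ⁿ⁾ = ℓ⁽ⁿ⁾(a) + Σ_{p+q=n, p,q≥1} u⁽ᵖ⁾ ∗ ℓ⁽ᵠ⁾(a),
-- which determines u⁽ⁿ⁾ because n is invertible in characteristic zero.  For w≻ it follows by
-- induction from w≻⁽ⁿ⁺¹⁾ = w≻⁽ⁿ⁾ ≻ a and the dendriform identity
--   (x ∗ y) ≻ a = x ≻ (y ▷ a) + (x ≻ a) ≺ y.
-- For the sum over compositions, split off the last part q of each composition of n: the denominator
-- of (i₁,…,iₖ,q) is that of (i₁,…,iₖ) times n, and the rest is a composition of p = n − q.
-- The ≺-formula is the ≻-formula in the opposite algebra (x ≺ᵒᵖ y = y ≻ x), which exchanges w≻ with w≺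
-- and ℓ with r, and reverses ∗-products.
module Submission where

open import Defs
open import Data.Nat using (ℕ; zero; suc; _≤_; _<_; s≤s; z≤n) renaming (_+_ to _+ℕ_; _*_ to _*ℕ_)
open import Data.Nat.Properties using (*-mono-≤; ≤-trans; m≤n+m; m<m+n)
open import Data.Nat.ListAction using (sum)
open import Data.Nat.Induction using (<-rec)
open import Data.Nat.Solver using (module +-*-Solver)
open import Data.List using (List; []; _∷_; map; foldr; _++_; _∷ʳ_; reverse)
open import Data.List.Properties using (map-++; map-∘; map-cong; unfold-reverse; ++-conicalʳ)
open import Data.List.Relation.Unary.All as All using (All; []; _∷_)
open import Data.List.Relation.Unary.All.Properties using (map⁺; ++⁺)
open import Data.Product using (_×_; _,_)
open import Function using (_∘_; case_of_)
open import Relation.Nullary using (¬_)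
open import Data.Empty using (⊥-elim)
import Relation.Binary.PropositionalEquality as ≡
open ≡ using (_≡_; _≢_)
open import Algebra.Bundles using (CommutativeMonoid)
open import Algebra.Module.Bundles using (Module)
import Relation.Binary.Reasoning.Setoid as SetoidReasoning

IsComposition : ℕ → List ℕ → Set
IsComposition n c = sum c ≡ n × All (1 ≤_) c

compositions-sound : ∀ n → All (IsComposition n) (compositions n)
compositions-sound zero          = (≡.refl , []) ∷ []
compositions-sound (suc zero)    = (≡.refl , s≤s z≤n ∷ []) ∷ []
compositions-sound (suc (suc n)) =
  ++⁺ (map⁺ (All.map prepend-one (compositions-sound (suc n))))
      (map⁺ (All.map bump (compositions-sound (suc n))))
  where
  prepend-one : ∀ {c} → IsComposition (suc n) c → IsComposition (suc (suc n)) (1 ∷ c)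
  prepend-one (Σc , pos) = ≡.cong suc Σc , s≤s z≤n ∷ pos

  bump : ∀ {c} → IsComposition (suc n) c → IsComposition (suc (suc n)) (bumpHead c)
  bump {[]}    (() , _)
  bump {_ ∷ _} (Σc , _ ∷ pos) = ≡.cong suc Σc , s≤s z≤n ∷ pos

bumpHead-∷ʳ : ∀ {n} c x → sum c ≡ suc n → bumpHead (c ∷ʳ x) ≡ bumpHead c ∷ʳ x
bumpHead-∷ʳ (_ ∷ _) x _ = ≡.refl

denomAux-∷ʳ : ∀ s c q → denomAux s (c ∷ʳ q) ≡ denomAux s c *ℕ (s +ℕ sum c +ℕ q)
denomAux-∷ʳ s []      q = solve 2 (λ s q → (s :+ q) :* con 1 := con 1 :* (s :+ con 0 :+ q)) ≡.refl s q
  where open +-*-Solver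
denomAux-∷ʳ s (i ∷ c) q = ≡.trans (≡.cong ((s +ℕ i) *ℕ_) (denomAux-∷ʳ (s +ℕ i) c q))
  (solve 5 (λ s i d t q → (s :+ i) :* (d :* (s :+ i :+ t :+ q)) := (s :+ i) :* d :* (s :+ (i :+ t) :+ q))
         ≡.refl s i (denomAux (s +ℕ i) c) (sum c) q)
  where open +-*-Solver

denomAux-positive : ∀ s c → All (1 ≤_) c → 1 ≤ denomAux s c
denomAux-positive s []      []         = s≤s z≤n
denomAux-positive s (i ∷ c) (1≤i ∷ pos) =
  *-mono-≤ (≤-trans 1≤i (m≤n+m i s)) (denomAux-positive (s +ℕ i) c pos)

module CommutativeMonoidSums {c ℓ} (M : CommutativeMonoid c ℓ) where
  open CommutativeMonoid M
  open import Algebra.Properties.CommutativeSemigroup commutativeSemigroup using (interchange)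
  open SetoidReasoning setoid

  Σ : List Carrier → Carrier
  Σ = foldr _∙_ ε

  Σ-++ : ∀ xs ys → Σ (xs ++ ys) ≈ Σ xs ∙ Σ ys
  Σ-++ []       ys = sym (identityˡ _)
  Σ-++ (x ∷ xs) ys = trans (∙-congˡ (Σ-++ xs ys)) (sym (assoc _ _ _))

  Σ-map-cong : ∀ {a p} {A : Set a} {P : A → Set p} {f g : A → Carrier} {xs} →
    (∀ {x} → P x → f x ≈ g x) → All P xs → Σ (map f xs) ≈ Σ (map g xs)
  Σ-map-cong f≈g []       = refl
  Σ-map-cong f≈g (p ∷ ps) = ∙-cong (f≈g p) (Σ-map-cong f≈g ps)

  Σ-map-homo : ∀ {a} {A : Set a} (h : Carrier → Carrier) →
    h ε ≈ ε → (∀ x y → h (x ∙ y) ≈ h x ∙ h y) →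
    ∀ (f : A → Carrier) xs → h (Σ (map f xs)) ≈ Σ (map (h ∘ f) xs)
  Σ-map-homo h h-ε h-∙ f []       = h-ε
  Σ-map-homo h h-ε h-∙ f (x ∷ xs) = trans (h-∙ _ _) (∙-congˡ (Σ-map-homo h h-ε h-∙ f xs))

  Σ-antidiagonal : (ℕ → ℕ → Carrier) → ℕ → Carrier
  Σ-antidiagonal f zero    = ε
  Σ-antidiagonal f (suc n) = f 0 n ∙ Σ-antidiagonal (f ∘ suc) n

  Σ-antidiagonal-cong : ∀ {f g} n → (∀ {i j} → i +ℕ suc j ≡ n → f i j ≈ g i j) →
    Σ-antidiagonal f n ≈ Σ-antidiagonal g n
  Σ-antidiagonal-cong zero    f≈g = refl
  Σ-antidiagonal-cong (suc n) f≈g = ∙-cong (f≈g ≡.refl) (Σ-antidiagonal-cong n (f≈g ∘ ≡.cong suc))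

  Σ-antidiagonal-∙ : ∀ f g n →
    Σ-antidiagonal (λ i j → f i j ∙ g i j) n ≈ Σ-antidiagonal f n ∙ Σ-antidiagonal g n
  Σ-antidiagonal-∙ f g zero    = sym (identityˡ ε)
  Σ-antidiagonal-∙ f g (suc n) =
    trans (∙-congˡ (Σ-antidiagonal-∙ (f ∘ suc) (g ∘ suc) n)) (interchange _ _ _ _)

  Σ-antidiagonal-homo : (h : Carrier → Carrier) → h ε ≈ ε → (∀ x y → h (x ∙ y) ≈ h x ∙ h y) →
    ∀ f n → h (Σ-antidiagonal f n) ≈ Σ-antidiagonal (λ i j → h (f i j)) n
  Σ-antidiagonal-homo h h-ε h-∙ f zero    = h-ε
  Σ-antidiagonal-homo h h-ε h-∙ f (suc n) =
    trans (h-∙ _ _) (∙-congˡ (Σ-antidiagonal-homo h h-ε h-∙ (f ∘ suc) n))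

  Σ-antidiagonal-last : ∀ f n →
    Σ-antidiagonal f (suc n) ≈ Σ-antidiagonal (λ i j → f i (suc j)) n ∙ f n 0
  Σ-antidiagonal-last f zero    = trans (identityʳ _) (sym (identityˡ _))
  Σ-antidiagonal-last f (suc n) =
    trans (∙-congˡ (Σ-antidiagonal-last (f ∘ suc) n)) (sym (assoc _ _ _))

  Σ-compositions-split : ∀ (f : List ℕ → Carrier) n →
    Σ (map f (compositions (suc (suc n)))) ≈
    Σ (map (f ∘ (1 ∷_)) (compositions (suc n))) ∙ Σ (map (f ∘ bumpHead) (compositions (suc n)))
  Σ-compositions-split f n = begin
    Σ (map f (map (1 ∷_) cs ++ map bumpHead cs))
      ≡⟨ ≡.cong Σ (map-++ f (map (1 ∷_) cs) (map bumpHead cs)) ⟩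
    Σ (map f (map (1 ∷_) cs) ++ map f (map bumpHead cs))
      ≈⟨ Σ-++ (map f (map (1 ∷_) cs)) _ ⟩
    Σ (map f (map (1 ∷_) cs)) ∙ Σ (map f (map bumpHead cs))
      ≡⟨ ≡.cong₂ (λ xs ys → Σ xs ∙ Σ ys) (map-∘ cs) (map-∘ cs) ⟨
    Σ (map (f ∘ (1 ∷_)) cs) ∙ Σ (map (f ∘ bumpHead) cs) ∎
    where cs = compositions (suc n)

  Σ-compositions-last : ∀ (f : List ℕ → Carrier) n →
    Σ (map f (compositions (suc n))) ≈
    f (suc n ∷ []) ∙ Σ-antidiagonal (λ i j → Σ (map (λ c → f (c ∷ʳ suc j)) (compositions (suc i)))) n
  Σ-compositions-last f zero    = refl
  Σ-compositions-last f (suc n) = begin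
    Σ (map f (compositions (suc (suc n))))
      ≈⟨ Σ-compositions-split f n ⟩
    Σ (map (f ∘ (1 ∷_)) (compositions (suc n))) ∙ Σ (map (f ∘ bumpHead) (compositions (suc n)))
      ≈⟨ ∙-cong (Σ-compositions-last (f ∘ (1 ∷_)) n) (Σ-compositions-last (f ∘ bumpHead) n) ⟩
    (f (1 ∷ suc n ∷ []) ∙ Σ-antidiagonal first n) ∙ (f (suc (suc n) ∷ []) ∙ Σ-antidiagonal bumped n)
      ≈⟨ solve 4 (λ x p y q → (x ⊕ p) ⊕ (y ⊕ q) ⊜ y ⊕ ((x ⊕ id) ⊕ (p ⊕ q))) refl _ _ _ _ ⟩
    f (suc (suc n) ∷ []) ∙ ((f (1 ∷ suc n ∷ []) ∙ ε) ∙ (Σ-antidiagonal first n ∙ Σ-antidiagonal bumped n))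
      ≈⟨ ∙-congˡ (∙-congˡ (Σ-antidiagonal-∙ first bumped n)) ⟨
    f (suc (suc n) ∷ []) ∙ ((f (1 ∷ suc n ∷ []) ∙ ε) ∙ Σ-antidiagonal (λ i j → first i j ∙ bumped i j) n)
      ≈⟨ ∙-congˡ (∙-congˡ (Σ-antidiagonal-cong n λ {i} {j} _ → split i j)) ⟨
    f (suc (suc n) ∷ []) ∙ ((f (1 ∷ suc n ∷ []) ∙ ε) ∙ Σ-antidiagonal (λ i j → last (suc i) j) n) ∎
    where
    open import Algebra.Solver.CommutativeMonoid M using (solve; _⊜_; _⊕_; id)
    last first bumped : ℕ → ℕ → Carrier
    last   i j = Σ (map (λ c → f (c ∷ʳ suc j)) (compositions (suc i)))
    first  i j = Σ (map (λ c → f (1 ∷ c ∷ʳ suc j)) (compositions (suc i)))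
    bumped i j = Σ (map (λ c → f (bumpHead (c ∷ʳ suc j))) (compositions (suc i)))

    split : ∀ i j → last (suc i) j ≈ first i j ∙ bumped i j
    split i j = trans (Σ-compositions-split (λ c → f (c ∷ʳ suc j)) i)
      (∙-congˡ (Σ-map-cong (λ {c} (Σc , _) → reflexive (≡.cong f (≡.sym (bumpHead-∷ʳ c (suc j) Σc))))
                           (compositions-sound (suc i))))

module FieldProperties {c ℓ} (F : Field c ℓ) where
  open Field F
  open SetoidReasoning setoid

  ι-homo-* : ∀ m n → ι F (m *ℕ n) ≈ ι F m * ι F n
  ι-homo-* m n = begin
    ι F (m *ℕ n)          ≡⟨ ι≡n·1 (m *ℕ n) ⟩
    (m *ℕ n) · 1#         ≈⟨ ×1-homo-* m n ⟩
    (m · 1#) * (n · 1#)   ≡⟨ ≡.cong₂ _*_ (ι≡n·1 m) (ι≡n·1 n) ⟨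
    ι F m * ι F n         ∎
    where
    open import Algebra.Properties.Semiring.Mult semiring using (×1-homo-*) renaming (_×_ to _·_)
    ι≡n·1 : ∀ n → ι F n ≡ n · 1#
    ι≡n·1 zero    = ≡.refl
    ι≡n·1 (suc n) = ≡.cong (1# +_) (ι≡n·1 n)

  ⁻¹-inverseˡ : ∀ {x} → ¬ x ≈ 0# → x ⁻¹ * x ≈ 1#
  ⁻¹-inverseˡ {x} x≉0 = trans (*-comm _ _) (⁻¹-inverse x x≉0)

  ⁻¹-unique : ∀ {x y} → ¬ x ≈ 0# → x * y ≈ 1# → y ≈ x ⁻¹
  ⁻¹-unique {x} {y} x≉0 xy≈1 = begin
    y                ≈⟨ *-identityˡ y ⟨
    1# * y           ≈⟨ *-congʳ (⁻¹-inverseˡ x≉0) ⟨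
    (x ⁻¹ * x) * y   ≈⟨ *-assoc _ _ _ ⟩
    x ⁻¹ * (x * y)   ≈⟨ *-congˡ xy≈1 ⟩
    x ⁻¹ * 1#        ≈⟨ *-identityʳ _ ⟩
    x ⁻¹             ∎

  module _ (char0 : CharZero F) where
    ι-nonzero : ∀ {n} → 1 ≤ n → ¬ ι F n ≈ 0#
    ι-nonzero {suc n} _ = char0 n

    ι[1]⁻¹≈1 : ι F 1 ⁻¹ ≈ 1#
    ι[1]⁻¹≈1 = sym (⁻¹-unique (char0 0) (trans (*-identityʳ _) (+-identityʳ 1#)))

    ι-denom-∷ʳ : ∀ {p q} c → IsComposition p c → 1 ≤ q →
      ι F (p +ℕ q) * ι F (denom (c ∷ʳ q)) ⁻¹ ≈ ι F (denom c) ⁻¹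
    ι-denom-∷ʳ {p} {q} c (Σc , pos) 1≤q = ⁻¹-unique (ι-nonzero (denomAux-positive 0 c pos)) (begin
      ι F (denom c) * (ι F (p +ℕ q) * ι F d′ ⁻¹)   ≈⟨ *-assoc _ _ _ ⟨
      (ι F (denom c) * ι F (p +ℕ q)) * ι F d′ ⁻¹   ≈⟨ *-congʳ (ι-homo-* (denom c) (p +ℕ q)) ⟨
      ι F (denom c *ℕ (p +ℕ q)) * ι F d′ ⁻¹        ≡⟨ ≡.cong (λ m → ι F m * ι F d′ ⁻¹) d′≡ ⟨
      ι F d′ * ι F d′ ⁻¹                           ≈⟨ ⁻¹-inverse _ (ι-nonzero d′-positive) ⟩
      1#                                           ∎)
      where
      d′ = denom (c ∷ʳ q)
      d′≡ : d′ ≡ denom c *ℕ (p +ℕ q)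
      d′≡ = ≡.trans (denomAux-∷ʳ 0 c q) (≡.cong (λ s → denom c *ℕ (s +ℕ q)) Σc)
      d′-positive : 1 ≤ d′
      d′-positive = denomAux-positive 0 (c ∷ʳ q) (++⁺ pos (1≤q ∷ []))

module ModuleProperties {c ℓ m ℓm} (F : Field c ℓ) (M : Module (Field.commutativeRing F) m ℓm) where
  open Field F using (_≈_; 0#; 1#; _⁻¹) renaming (_*_ to _*F_)
  open Module M
  open FieldProperties F using (⁻¹-inverseˡ)
  open SetoidReasoning ≈ᴹ-setoid

  ι-suc-*ₗ : ∀ n x → ι F (suc n) *ₗ x ≈ᴹ x +ᴹ ι F n *ₗ x
  ι-suc-*ₗ n x = ≈ᴹ-trans (*ₗ-distribʳ x 1# (ι F n)) (+ᴹ-congʳ (*ₗ-identityˡ x))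

  *ₗ-cancelˡ : ∀ {s x y} → ¬ s ≈ 0# → s *ₗ x ≈ᴹ s *ₗ y → x ≈ᴹ y
  *ₗ-cancelˡ {s} {x} {y} s≉0 sx≈sy = begin
    x                  ≈⟨ *ₗ-identityˡ x ⟨
    1# *ₗ x            ≈⟨ *ₗ-congʳ (⁻¹-inverseˡ s≉0) ⟨
    (s ⁻¹ *F s) *ₗ x   ≈⟨ *ₗ-assoc _ _ _ ⟩
    s ⁻¹ *ₗ (s *ₗ x)   ≈⟨ *ₗ-congˡ sx≈sy ⟩
    s ⁻¹ *ₗ (s *ₗ y)   ≈⟨ *ₗ-assoc _ _ _ ⟨
    (s ⁻¹ *F s) *ₗ y   ≈⟨ *ₗ-congʳ (⁻¹-inverseˡ s≉0) ⟩
    1# *ₗ y            ≈⟨ *ₗ-identityˡ y ⟩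
    y                  ∎

module DendriformProperties {c ℓ m ℓm} {F : Field c ℓ} (D : Dendriform F m ℓm) where
  open Field F using (0#)
  open Dendriform D
  open import Algebra.Properties.CommutativeSemigroup
    (CommutativeMonoid.commutativeSemigroup +ᴹ-commutativeMonoid) using (interchange)
  open import Algebra.Properties.AbelianGroup +ᴹ-abelianGroup using (//-rightDividesˡ)
  open SetoidReasoning ≈ᴹ-setoid

  ≺-zeroˡ : ∀ y → 0ᴹ ≺ y ≈ᴹ 0ᴹ
  ≺-zeroˡ y = ≈ᴹ-trans (≺-cong (≈ᴹ-sym (*ₗ-zeroˡ 0ᴹ)) ≈ᴹ-refl) (≈ᴹ-trans (≺-*ₗˡ 0# 0ᴹ y) (*ₗ-zeroˡ _))

  ≻-zeroˡ : ∀ y → 0ᴹ ≻ y ≈ᴹ 0ᴹ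
  ≻-zeroˡ y = ≈ᴹ-trans (≻-cong (≈ᴹ-sym (*ₗ-zeroˡ 0ᴹ)) ≈ᴹ-refl) (≈ᴹ-trans (≻-*ₗˡ 0# 0ᴹ y) (*ₗ-zeroˡ _))

  ∗-cong : ∀ {x x′ y y′} → x ≈ᴹ x′ → y ≈ᴹ y′ → x ∗ y ≈ᴹ x′ ∗ y′
  ∗-cong x≈x′ y≈y′ = +ᴹ-cong (≺-cong x≈x′ y≈y′) (≻-cong x≈x′ y≈y′)

  ∗-zeroˡ : ∀ y → 0ᴹ ∗ y ≈ᴹ 0ᴹ
  ∗-zeroˡ y = ≈ᴹ-trans (+ᴹ-cong (≺-zeroˡ y) (≻-zeroˡ y)) (+ᴹ-identityˡ 0ᴹ)

  ∗-+ˡ : ∀ x y z → (x +ᴹ y) ∗ z ≈ᴹ x ∗ z +ᴹ y ∗ z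
  ∗-+ˡ x y z = ≈ᴹ-trans (+ᴹ-cong (≺-+ˡ x y z) (≻-+ˡ x y z)) (interchange _ _ _ _)

  ∗-*ₗˡ : ∀ s x y → (s *ₗ x) ∗ y ≈ᴹ s *ₗ (x ∗ y)
  ∗-*ₗˡ s x y = ≈ᴹ-trans (+ᴹ-cong (≺-*ₗˡ s x y) (≻-*ₗˡ s x y)) (≈ᴹ-sym (*ₗ-distribˡ s _ _))

  ∗-assoc : ∀ x y z → (x ∗ y) ∗ z ≈ᴹ x ∗ (y ∗ z)
  ∗-assoc x y z = begin
    (x ∗ y) ∗ z
      ≈⟨ +ᴹ-congʳ (≺-+ˡ _ _ z) ⟩
    ((x ≺ y) ≺ z +ᴹ (x ≻ y) ≺ z) +ᴹ (x ∗ y) ≻ z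
      ≈⟨ +ᴹ-cong (+ᴹ-cong (dend₁ x y z) (dend₂ x y z)) (≈ᴹ-sym (dend₃ x y z)) ⟩
    (x ≺ (y ∗ z) +ᴹ x ≻ (y ≺ z)) +ᴹ x ≻ (y ≻ z)
      ≈⟨ +ᴹ-assoc _ _ _ ⟩
    x ≺ (y ∗ z) +ᴹ (x ≻ (y ≺ z) +ᴹ x ≻ (y ≻ z))
      ≈⟨ +ᴹ-congˡ (≻-+ʳ x _ _) ⟨
    x ∗ (y ∗ z) ∎

  ∏∗-∷ʳ : ∀ xs y → xs ≢ [] → ∏∗ (xs ∷ʳ y) ≈ᴹ ∏∗ xs ∗ y
  ∏∗-∷ʳ []           y xs≢[] = ⊥-elim (xs≢[] ≡.refl)
  ∏∗-∷ʳ (x ∷ [])     y _     = ≈ᴹ-refl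
  ∏∗-∷ʳ (x ∷ x′ ∷ xs) y _    = begin
    x ∗ ∏∗ ((x′ ∷ xs) ∷ʳ y)   ≈⟨ ∗-cong ≈ᴹ-refl (∏∗-∷ʳ (x′ ∷ xs) y λ ()) ⟩
    x ∗ (∏∗ (x′ ∷ xs) ∗ y)    ≈⟨ ∗-assoc _ _ _ ⟨
    (x ∗ ∏∗ (x′ ∷ xs)) ∗ y    ∎

  [y▷z]+z≺y≈y≻z : ∀ y z → y ▷ z +ᴹ z ≺ y ≈ᴹ y ≻ z
  [y▷z]+z≺y≈y≻z y z = //-rightDividesˡ (z ≺ y) (y ≻ z)

  [x∗y]≻z≈x≻[y▷z]+[x≻z]≺y : ∀ x y z → (x ∗ y) ≻ z ≈ᴹ x ≻ (y ▷ z) +ᴹ (x ≻ z) ≺ y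
  [x∗y]≻z≈x≻[y▷z]+[x≻z]≺y x y z = begin
    (x ∗ y) ≻ z                     ≈⟨ dend₃ x y z ⟨
    x ≻ (y ≻ z)                     ≈⟨ ≻-cong ≈ᴹ-refl ([y▷z]+z≺y≈y≻z y z) ⟨
    x ≻ (y ▷ z +ᴹ z ≺ y)            ≈⟨ ≻-+ʳ x _ _ ⟩
    x ≻ (y ▷ z) +ᴹ x ≻ (z ≺ y)      ≈⟨ +ᴹ-congˡ (dend₂ x z y) ⟨
    x ≻ (y ▷ z) +ᴹ (x ≻ z) ≺ y      ∎

module Recursion {c ℓ′ m ℓm} {F : Field c ℓ′} (D : Dendriform F m ℓm) (a : Dendriform.Carrierᴹ D) where
  open Field F using (1#; _*_) renaming (_≈_ to _≈F_; trans to ≈F-trans)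
  open Dendriform D
  open DendriformProperties D
  open ModuleProperties F module′
  open CommutativeMonoidSums +ᴹ-commutativeMonoid
  open SetoidReasoning ≈ᴹ-setoid

  SolvesRecursion : (ℕ → Carrierᴹ) → Set ℓm
  SolvesRecursion u = ∀ n →
    ι F (suc n) *ₗ u (suc n) ≈ᴹ ℓ⁽ suc n ⁾ a +ᴹ Σ-antidiagonal (λ i j → u (suc i) ∗ ℓ⁽ suc j ⁾ a) n

  w≻-solves : SolvesRecursion (λ n → w≻ n a)
  w≻-solves zero    = ≈ᴹ-trans (ι-suc-*ₗ 0 a) (+ᴹ-congˡ (*ₗ-zeroˡ a))
  w≻-solves (suc n) = begin
    ι F (suc (suc n)) *ₗ w (suc (suc n))
      ≈⟨ ι-suc-*ₗ (suc n) _ ⟩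
    w (suc (suc n)) +ᴹ ι F (suc n) *ₗ (w (suc n) ≻ a)
      ≈⟨ +ᴹ-congˡ (≻-*ₗˡ _ _ a) ⟨
    w (suc (suc n)) +ᴹ (ι F (suc n) *ₗ w (suc n)) ≻ a
      ≈⟨ +ᴹ-congˡ (≈ᴹ-trans (≻-cong (w≻-solves n) ≈ᴹ-refl) (≻-+ˡ _ _ a)) ⟩
    w (suc (suc n)) +ᴹ (ℓ (suc n) ≻ a +ᴹ Σ-antidiagonal products n ≻ a)
      ≈⟨ +ᴹ-congˡ (+ᴹ-cong (≈ᴹ-sym ([y▷z]+z≺y≈y≻z _ a)) Σ-antidiagonal-≻a) ⟩
    w (suc (suc n)) +ᴹ ((ℓ (suc (suc n)) +ᴹ a ≺ ℓ (suc n)) +ᴹ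
                        (Σ-antidiagonal (λ i j → right i (suc j)) n +ᴹ Σ-antidiagonal (left ∘ suc) n))
      ≈⟨ solve 5 (λ w l x y z → w ⊕ ((l ⊕ x) ⊕ (y ⊕ z)) ⊜ l ⊕ ((x ⊕ z) ⊕ (y ⊕ w))) ≈ᴹ-refl _ _ _ _ _ ⟩
    ℓ (suc (suc n)) +ᴹ ((a ≺ ℓ (suc n) +ᴹ Σ-antidiagonal (left ∘ suc) n) +ᴹ
                        (Σ-antidiagonal (λ i j → right i (suc j)) n +ᴹ w (suc (suc n))))
      ≈⟨ +ᴹ-congˡ (+ᴹ-congˡ (Σ-antidiagonal-last right n)) ⟨
    ℓ (suc (suc n)) +ᴹ (Σ-antidiagonal left (suc n) +ᴹ Σ-antidiagonal right (suc n))
      ≈⟨ +ᴹ-congˡ (Σ-antidiagonal-∙ left right (suc n)) ⟨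
    ℓ (suc (suc n)) +ᴹ Σ-antidiagonal products (suc n) ∎
    where
    open import Algebra.Solver.CommutativeMonoid +ᴹ-commutativeMonoid using (solve; _⊜_; _⊕_)
    w ℓ : ℕ → Carrierᴹ
    w p = w≻ p a
    ℓ q = ℓ⁽ q ⁾ a
    products left right : ℕ → ℕ → Carrierᴹ
    products i j = w (suc i) ∗ ℓ (suc j)
    left     i j = w (suc i) ≺ ℓ (suc j)
    right    i j = w (suc i) ≻ ℓ (suc j)

    Σ-antidiagonal-≻a : Σ-antidiagonal products n ≻ a ≈ᴹ
      Σ-antidiagonal (λ i j → right i (suc j)) n +ᴹ Σ-antidiagonal (left ∘ suc) n
    Σ-antidiagonal-≻a = begin
      Σ-antidiagonal products n ≻ a
        ≈⟨ Σ-antidiagonal-homo (_≻ a) (≻-zeroˡ a) (λ x y → ≻-+ˡ x y a) products n ⟩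
      Σ-antidiagonal (λ i j → products i j ≻ a) n
        ≈⟨ Σ-antidiagonal-cong n (λ {i} {j} _ → [x∗y]≻z≈x≻[y▷z]+[x≻z]≺y (w (suc i)) (ℓ (suc j)) a) ⟩
      Σ-antidiagonal (λ i j → right i (suc j) +ᴹ left (suc i) j) n
        ≈⟨ Σ-antidiagonal-∙ _ _ n ⟩
      Σ-antidiagonal (λ i j → right i (suc j)) n +ᴹ Σ-antidiagonal (left ∘ suc) n ∎

  ℓ-monomial : List ℕ → Carrierᴹ
  ℓ-monomial c = ∏∗ (map (λ i → ℓ⁽ i ⁾ a) c)

  ℓ-monomial-∷ʳ : ∀ i is q → ℓ-monomial ((i ∷ is) ∷ʳ q) ≈ᴹ ℓ-monomial (i ∷ is) ∗ ℓ⁽ q ⁾ a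
  ℓ-monomial-∷ʳ i is q =
    ≈ᴹ-trans (≈ᴹ-reflexive (≡.cong ∏∗ (map-++ _ (i ∷ is) (q ∷ []))))
             (∏∗-∷ʳ (map (λ j → ℓ⁽ j ⁾ a) (i ∷ is)) _ λ ())

  module _ (char0 : CharZero F) where
    open FieldProperties F using (ι-denom-∷ʳ; ι[1]⁻¹≈1; ι-nonzero)

    term : List ℕ → Carrierᴹ
    term c = coeff D c *ₗ ℓ-monomial c

    ι-*ₗ-term-∷ʳ : ∀ {p q} c → IsComposition (suc p) c → 1 ≤ q →
      ι F (suc p +ℕ q) *ₗ term (c ∷ʳ q) ≈ᴹ term c ∗ ℓ⁽ q ⁾ a
    ι-*ₗ-term-∷ʳ []           (() , _) _
    ι-*ₗ-term-∷ʳ {p} {q} c@(i ∷ is) comp 1≤q = begin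
      ι F (suc p +ℕ q) *ₗ (coeff D (c ∷ʳ q) *ₗ ℓ-monomial (c ∷ʳ q))
        ≈⟨ *ₗ-assoc _ _ _ ⟨
      (ι F (suc p +ℕ q) * coeff D (c ∷ʳ q)) *ₗ ℓ-monomial (c ∷ʳ q)
        ≈⟨ *ₗ-cong (ι-denom-∷ʳ char0 c comp 1≤q) (ℓ-monomial-∷ʳ i is q) ⟩
      coeff D c *ₗ (ℓ-monomial c ∗ ℓ⁽ q ⁾ a)
        ≈⟨ ∗-*ₗˡ _ _ _ ⟨
      term c ∗ ℓ⁽ q ⁾ a ∎

    ι-*ₗ-Σ-term-∷ʳ : ∀ {i j n} → i +ℕ suc j ≡ n →
      ι F (suc n) *ₗ Σ (map (λ c → term (c ∷ʳ suc j)) (compositions (suc i))) ≈ᴹ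
      rhs≻ D (suc i) a ∗ ℓ⁽ suc j ⁾ a
    ι-*ₗ-Σ-term-∷ʳ {i} {j} ≡.refl = begin
      ι F (suc i +ℕ suc j) *ₗ Σ (map (λ c → term (c ∷ʳ suc j)) cs)
        ≈⟨ Σ-map-homo (ι F (suc i +ℕ suc j) *ₗ_) (*ₗ-zeroʳ _) (*ₗ-distribˡ _) _ cs ⟩
      Σ (map (λ c → ι F (suc i +ℕ suc j) *ₗ term (c ∷ʳ suc j)) cs)
        ≈⟨ Σ-map-cong (λ {c} comp → ι-*ₗ-term-∷ʳ c comp (s≤s z≤n)) (compositions-sound (suc i)) ⟩
      Σ (map (λ c → term c ∗ ℓ⁽ suc j ⁾ a) cs)
        ≈⟨ Σ-map-homo (_∗ ℓ⁽ suc j ⁾ a) (∗-zeroˡ _) (λ x y → ∗-+ˡ x y _) term cs ⟨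
      Σ (map term cs) ∗ ℓ⁽ suc j ⁾ a ∎
      where cs = compositions (suc i)

    rhs≻-solves : SolvesRecursion (λ n → rhs≻ D n a)
    rhs≻-solves n = begin
      ι F (suc n) *ₗ Σ (map term (compositions (suc n)))
        ≈⟨ *ₗ-congˡ (Σ-compositions-last term n) ⟩
      ι F (suc n) *ₗ (term (suc n ∷ []) +ᴹ Σ-antidiagonal last-parts n)
        ≈⟨ *ₗ-distribˡ _ _ _ ⟩
      ι F (suc n) *ₗ term (suc n ∷ []) +ᴹ ι F (suc n) *ₗ Σ-antidiagonal last-parts n
        ≈⟨ +ᴹ-cong leading (Σ-antidiagonal-homo _ (*ₗ-zeroʳ _) (*ₗ-distribˡ _) last-parts n) ⟩
      ℓ⁽ suc n ⁾ a +ᴹ Σ-antidiagonal (λ i j → ι F (suc n) *ₗ last-parts i j) n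
        ≈⟨ +ᴹ-congˡ (Σ-antidiagonal-cong n ι-*ₗ-Σ-term-∷ʳ) ⟩
      ℓ⁽ suc n ⁾ a +ᴹ Σ-antidiagonal (λ i j → rhs≻ D (suc i) a ∗ ℓ⁽ suc j ⁾ a) n ∎
      where
      last-parts : ℕ → ℕ → Carrierᴹ
      last-parts i j = Σ (map (λ c → term (c ∷ʳ suc j)) (compositions (suc i)))

      leading : ι F (suc n) *ₗ term (suc n ∷ []) ≈ᴹ ℓ⁽ suc n ⁾ a
      leading = begin
        ι F (suc n) *ₗ (coeff D (suc n ∷ []) *ₗ ℓ⁽ suc n ⁾ a)   ≈⟨ *ₗ-assoc _ _ _ ⟨
        (ι F (suc n) * coeff D (suc n ∷ [])) *ₗ ℓ⁽ suc n ⁾ a     ≈⟨ *ₗ-congʳ ι[n]*coeff[n]≈1 ⟩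
        1# *ₗ ℓ⁽ suc n ⁾ a                                       ≈⟨ *ₗ-identityˡ _ ⟩
        ℓ⁽ suc n ⁾ a                                             ∎
        where
        ι[n]*coeff[n]≈1 : ι F (suc n) * coeff D (suc n ∷ []) ≈F 1#
        ι[n]*coeff[n]≈1 =
          ≈F-trans (ι-denom-∷ʳ char0 {0} {suc n} [] (≡.refl , []) (s≤s z≤n)) (ι[1]⁻¹≈1 char0)

    solutions-unique : ∀ {u v} → SolvesRecursion u → SolvesRecursion v → ∀ n → u (suc n) ≈ᴹ v (suc n)
    solutions-unique {u} {v} u-solves v-solves = <-rec (λ n → u (suc n) ≈ᴹ v (suc n)) λ n ih →
      *ₗ-cancelˡ (ι-nonzero char0 {suc n} (s≤s z≤n)) (begin
        ι F (suc n) *ₗ u (suc n)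
          ≈⟨ u-solves n ⟩
        ℓ⁽ suc n ⁾ a +ᴹ Σ-antidiagonal (λ i j → u (suc i) ∗ ℓ⁽ suc j ⁾ a) n
          ≈⟨ +ᴹ-congˡ (Σ-antidiagonal-cong n λ e → ∗-cong (ih (i<n e)) ≈ᴹ-refl) ⟩
        ℓ⁽ suc n ⁾ a +ᴹ Σ-antidiagonal (λ i j → v (suc i) ∗ ℓ⁽ suc j ⁾ a) n
          ≈⟨ v-solves n ⟨
        ι F (suc n) *ₗ v (suc n) ∎)
      where
      i<n : ∀ {i j n} → i +ℕ suc j ≡ n → i < n
      i<n {i} e = ≡.subst (i <_) e (m<m+n i (s≤s z≤n))

    w≻≈rhs≻ : ∀ n → w≻ (suc n) a ≈ᴹ rhs≻ D (suc n) a
    w≻≈rhs≻ = solutions-unique {λ n → w≻ n a} {λ n → rhs≻ D n a} w≻-solves rhs≻-solves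

opposite : ∀ {c ℓ m ℓm} {F : Field c ℓ} → Dendriform F m ℓm → Dendriform F m ℓm
opposite D = record
  { module′ = module′
  ; _≺_     = λ x y → y ≻ x
  ; _≻_     = λ x y → y ≺ x
  ; ≺-cong  = λ x≈x′ y≈y′ → ≻-cong y≈y′ x≈x′
  ; ≻-cong  = λ x≈x′ y≈y′ → ≺-cong y≈y′ x≈x′
  ; ≺-+ˡ    = λ x y z → ≻-+ʳ z x y
  ; ≺-+ʳ    = λ x y z → ≻-+ˡ y z x
  ; ≻-+ˡ    = λ x y z → ≺-+ʳ z x y
  ; ≻-+ʳ    = λ x y z → ≺-+ˡ y z x
  ; ≺-*ₗˡ   = λ s x y → ≻-*ₗʳ s y x
  ; ≺-*ₗʳ   = λ s x y → ≻-*ₗˡ s y x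
  ; ≻-*ₗˡ   = λ s x y → ≺-*ₗʳ s y x
  ; ≻-*ₗʳ   = λ s x y → ≺-*ₗˡ s y x
  ; dend₁   = λ a b c → ≈ᴹ-trans (dend₃ c b a) (≻-cong (+ᴹ-comm _ _) ≈ᴹ-refl)
  ; dend₂   = λ a b c → ≈ᴹ-sym (dend₂ c b a)
  ; dend₃   = λ a b c → ≈ᴹ-trans (dend₁ c b a) (≺-cong ≈ᴹ-refl (+ᴹ-comm _ _))
  }
  where open Dendriform D

module Opposite {c ℓ m ℓm} {F : Field c ℓ} (D : Dendriform F m ℓm) where
  open Dendriform D
  open DendriformProperties D
  open CommutativeMonoidSums +ᴹ-commutativeMonoid using (Σ-map-cong)
  open SetoidReasoning ≈ᴹ-setoid
  module Dᵒᵖ = Dendriform (opposite D)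

  w≻-opposite : ∀ n a → Dᵒᵖ.w≻ n a ≡ w≺ n a
  w≻-opposite zero          a = ≡.refl
  w≻-opposite (suc zero)    a = ≡.refl
  w≻-opposite (suc (suc n)) a = ≡.cong (a ≺_) (w≻-opposite (suc n) a)

  ℓ-opposite : ∀ n a → Dᵒᵖ.ℓ⁽ n ⁾ a ≡ r⁽ n ⁾ a
  ℓ-opposite zero          a = ≡.refl
  ℓ-opposite (suc zero)    a = ≡.refl
  ℓ-opposite (suc (suc n)) a = ≡.cong (a ◁_) (ℓ-opposite (suc n) a)

  ∏∗-opposite : ∀ xs → Dᵒᵖ.∏∗ xs ≈ᴹ ∏∗ (reverse xs)
  ∏∗-opposite []           = ≈ᴹ-refl
  ∏∗-opposite (x ∷ [])     = ≈ᴹ-refl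
  ∏∗-opposite (x ∷ y ∷ xs) = begin
    x Dᵒᵖ.∗ Dᵒᵖ.∏∗ (y ∷ xs)          ≈⟨ +ᴹ-comm _ _ ⟩
    Dᵒᵖ.∏∗ (y ∷ xs) ∗ x              ≈⟨ ∗-cong (∏∗-opposite (y ∷ xs)) ≈ᴹ-refl ⟩
    ∏∗ (reverse (y ∷ xs)) ∗ x        ≈⟨ ∏∗-∷ʳ (reverse (y ∷ xs)) x reverse-nonempty ⟨
    ∏∗ (reverse (y ∷ xs) ∷ʳ x)       ≡⟨ ≡.cong ∏∗ (unfold-reverse x (y ∷ xs)) ⟨
    ∏∗ (reverse (x ∷ y ∷ xs))        ∎
    where
    reverse-nonempty : reverse (y ∷ xs) ≢ []
    reverse-nonempty e =
      case ++-conicalʳ (reverse xs) (y ∷ []) (≡.trans (≡.sym (unfold-reverse y xs)) e) of λ ()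

  rhs≻-opposite : ∀ n a → rhs≻ (opposite D) n a ≈ᴹ rhs≺ D n a
  rhs≻-opposite n a = Σ-map-cong (λ {c} _ → *ₗ-congˡ (begin
    Dᵒᵖ.∏∗ (map (λ i → Dᵒᵖ.ℓ⁽ i ⁾ a) c)   ≡⟨ ≡.cong Dᵒᵖ.∏∗ (map-cong (λ i → ℓ-opposite i a) c) ⟩
    Dᵒᵖ.∏∗ (map (λ i → r⁽ i ⁾ a) c)       ≈⟨ ∏∗-opposite (map (λ i → r⁽ i ⁾ a) c) ⟩
    ∏∗ (reverse (map (λ i → r⁽ i ⁾ a) c)) ∎))
    (compositions-sound n)

theorem3p2 : ∀ {c ℓ m ℓm} (F : Field c ℓ) → CharZero F →
    (D : Dendriform F m ℓm) → (a : Dendriform.Carrierᴹ D) → (n : ℕ) → 1 ≤ n →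
    Dendriform._≈ᴹ_ D (Dendriform.w≻ D n a) (rhs≻ D n a)
      × Dendriform._≈ᴹ_ D (Dendriform.w≺ D n a) (rhs≺ D n a)
theorem3p2 F char0 D a (suc n) _ = Recursion.w≻≈rhs≻ D a char0 n , (begin
  w≺ (suc n) a                     ≡⟨ w≻-opposite (suc n) a ⟨
  Dᵒᵖ.w≻ (suc n) a                 ≈⟨ Recursion.w≻≈rhs≻ (opposite D) a char0 n ⟩
  rhs≻ (opposite D) (suc n) a      ≈⟨ rhs≻-opposite (suc n) a ⟩
  rhs≺ D (suc n) a                 ∎)
  where
  open Dendriform D
  open Opposite D
  open SetoidReasoning ≈ᴹ-setoid
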